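{- Let $a\ge b\ge 2$ be integers, $n=a+b+1$, and let $I=i_1\cdots i_z\in\mathcal W_>$. For $1\le r\le q-p$ (with $p,q$ computed for $I$), let $H_r=\overline{L_r}\,R_r=i_{p+r}i_{p+r-1}\cdots i_1\,i_{p+r+1}\cdots i_z$. Then $R_{H_r}=R_r$ for all $1\le r\le q-p$, and \[\psi^{ -1}(I)\cap\mathcal W_\le=\{H_1,\dots,H_{q-p}\},\] where $\psi^{ -1}(I)=\{J\in\mathcal W:\psi(J)=I\}$.
   Context: A composition $I=i_1\cdots i_z\vDash n$ is a sequence of positive integers with sum $n$; $\overline I=i_z\cdots i_1$; concatenation of compositions is juxtaposition. $\Theta_I^-(x)=x-\max\{|i_1\cdots i_k|:0\le k\le z,\ |i_1\cdots i_k|\le x\}$, where $|i_1\cdots i_k|=i_1+\dots+i_k$. For a composition $I$, the integers $p,s,q,t$ are defined by $b+1=i_1+\dots+i_{p-1}+s=i_2+\dots+i_q+t$ with $1\le p,q\le z$, $1\le s\le i_p$, $1\le t\le i_{q+1}$, where $i_{z+1}=i_1$. For $0\le j\le z-p$, $L_j=i_1\cdots i_{p+j}$ and $R_j=i_{p+j+1}\cdots i_z$; $L_I=L_0$, $R_I=R_0$ (so $R_{H_r}$ means $R_0$ computed for the composition $H_r$ with its own $p$). $\mathcal W$ is the set of compositions of $n$ with all parts at least $2$; $\mathcal W_>=\{I\in\mathcal W: i_1>\Theta^-_{\overline I}(a)\}$, $\mathcal W_\le=\{I\in\mathcal W:i_1\le\Theta^-_{\overline I}(a)\}$. The map $\psi\colon\mathcal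 W\to\mathcal W$ is $\psi(I)=\overline{L_I}\,R_I$. -}

module Defs where

open import Data.Nat using (ℕ; zero; suc; _+_; _∸_; _≤_; _≤?_; _⊔_)
open import Data.List using (List; []; _∷_; _++_; [_]; take; drop; reverse; inits; map; filter; foldr)
open import Data.List.Relation.Unary.All using (All)
open import Data.Nat.ListAction using (sum)
open import Data.Bool using (if_then_else_)
open import Relation.Nullary.Decidable using (⌊_⌋)
open import Relation.Binary.PropositionalEquality using (_≡_)
open import Data.Product using (_×_)

InW : ℕ → List ℕ → Set
InW n I = All (λ i → 2 ≤ i) I × sum I ≡ n

-- first part i₁ (junk value 0 on the empty list, never used for I ∈ 𝒲)
head₀ : List ℕ → ℕ
head₀ []      = 0
head₀ (i ∷ _) = i

partialSums : List ℕ → List ℕ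
partialSums I = map sum (inits I)

Θ⁻ : List ℕ → ℕ → ℕ
Θ⁻ I x = x ∸ foldr _⊔_ 0 (filter (λ m → m ≤? x) (partialSums I))

-- idx y I = the unique k with i₁+⋯+i_{k-1} < y ≤ i₁+⋯+i_k,
-- i.e. y = i₁+⋯+i_{k-1}+s with 1 ≤ s ≤ i_k (for y ≥ 1, 0 < y ≤ |I|).
idx : ℕ → List ℕ → ℕ
idx y []      = 0
idx y (i ∷ I) = if ⌊ y ≤? i ⌋ then 1 else suc (idx (y ∸ i) I)

rotate : List ℕ → List ℕ
rotate []      = []
rotate (i ∷ I) = I ++ [ i ]

pOf : ℕ → List ℕ → ℕ
pOf b I = idx (suc b) I

-- q : b+1 = i₂+⋯+i_q+t with 1 ≤ t ≤ i_{q+1}, i_{z+1} = i₁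
qOf : ℕ → List ℕ → ℕ
qOf b I = idx (suc b) (rotate I)

L : ℕ → List ℕ → ℕ → List ℕ
L b I j = take (pOf b I + j) I

R : ℕ → List ℕ → ℕ → List ℕ
R b I j = drop (pOf b I + j) I

ψ : ℕ → List ℕ → List ℕ
ψ b I = reverse (L b I 0) ++ R b I 0

H : ℕ → List ℕ → ℕ → List ℕ
H b I r = reverse (L b I r) ++ R b I r

{-# OPTIONS --safe #-}
module Submission where

-- Write p = k+1 and q = k′+1: b+1 falls into part k+1 of I and into part k′+1 of the rotation
-- i₂⋯i_z i₁.  Reversing the first t+1 parts is an involution; it keeps the sum of those parts
-- and turns j₂+⋯+j_{t+1} into the sum of the first t parts.  The partial sums of \overline J are
-- the suffix sums of J, and since n = a + (b+1) a suffix sum is at most a exactly when the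
-- complementary prefix sum is at least b+1; so when p_J = t+1, J ∈ 𝒲_≤ reads
-- j₁ + b + 1 ≤ j₁+⋯+j_{t+1}.  Hence J ∈ ψ⁻¹(I) ∩ 𝒲_≤ iff J reverses the first t+1 parts of I
-- with i₂+⋯+i_{t+1} < b+1 (that is t < q) and b+1 ≤ i₁+⋯+i_t (that is p ≤ t): these are the
-- H_r with t+1 = p+r.

open import Defs
open import Data.Nat using (ℕ; zero; suc; _+_; _∸_; _≤_; _<_; _≤?_; _⊔_; z≤n; s≤s)
open import Data.Nat.Properties
open import Data.List using (List; []; _∷_; _++_; [_]; _∷ʳ_; take; drop; reverse; inits; map; filter; foldr; length)
open import Data.List.Properties
  using (unfold-reverse; reverse-involutive; take++drop≡id; length-take; length-reverse; map-++; ++-assoc; foldr-preservesᵒ; foldr-preservesᵇ)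
import Data.List.Relation.Unary.All as All
open import Data.List.Relation.Unary.Any using (here)
open import Data.List.Membership.Propositional using (_∈_; lose)
open import Data.List.Membership.Propositional.Properties using (∈-filter⁺; ∈-filter⁻; ∈-++⁺ˡ; ∈-++⁺ʳ; ∈-++⁻)
open import Data.List.Relation.Binary.Permutation.Propositional using (_↭_; ↭-refl; ↭-sym)
open import Data.List.Relation.Binary.Permutation.Propositional.Properties
  using (↭-reverse; ++⁺ʳ; ++-comm; ↭-length; All-resp-↭)
open import Data.Nat.ListAction using (sum)
open import Data.Nat.ListAction.Properties using (sum-++; sum-↭)
open import Data.Product using (_×_; _,_; ∃-syntax; proj₁; proj₂)
open import Data.Empty using (⊥-elim)
open import Relation.Nullary using (yes; no; ¬_)
open import Data.Sum using (inj₁; inj₂; [_,_]′)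
open import Function using (_∘_)
open import Function.Bundles using (_⇔_; mk⇔; Equivalence)
import Function.Properties.Equivalence as ⇔
open import Relation.Binary.PropositionalEquality using (_≡_; refl; sym; trans; cong; cong₂; subst; module ≡-Reasoning)

take-++-exact : ∀ {A : Set} {m} (X Y : List A) → length X ≡ m → take m (X ++ Y) ≡ X
take-++-exact []      Y refl = refl
take-++-exact (x ∷ X) Y refl = cong (x ∷_) (take-++-exact X Y refl)

drop-++-exact : ∀ {A : Set} {m} (X Y : List A) → length X ≡ m → drop m (X ++ Y) ≡ Y
drop-++-exact []      Y refl = refl
drop-++-exact (x ∷ X) Y refl = drop-++-exact X Y refl

take-++-short : ∀ {A : Set} {m} (X Y : List A) → m ≤ length X → take m (X ++ Y) ≡ take m X
take-++-short {m = zero}  X       Y _         = refl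
take-++-short {m = suc m} (x ∷ X) Y (s≤s m≤) = cong (x ∷_) (take-++-short X Y m≤)

length-reverse-take : ∀ {A : Set} {m} (K : List A) → m ≤ length K → length (reverse (take m K)) ≡ m
length-reverse-take {m = m} K m≤ =
  trans (length-reverse (take m K)) (trans (length-take m K) (m≤n⇒m⊓n≡m m≤))

sum-reverse : ∀ K → sum (reverse K) ≡ sum K
sum-reverse K = sum-↭ (↭-reverse K)

inits-∷ʳ : ∀ {A : Set} (K : List A) x → inits (K ∷ʳ x) ≡ inits K ∷ʳ (K ∷ʳ x)
inits-∷ʳ []      x = refl
inits-∷ʳ (y ∷ K) x =
  cong ([] ∷_) (trans (cong (map (y ∷_)) (inits-∷ʳ K x)) (map-++ (y ∷_) (inits K) _))

maxAtMost : ℕ → List ℕ → ℕ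
maxAtMost x L = foldr _⊔_ 0 (filter (_≤? x) L)

≤-maxAtMost : ∀ {x m L} → m ∈ L → m ≤ x → m ≤ maxAtMost x L
≤-maxAtMost {x} {m} m∈L m≤x =
  foldr-preservesᵒ (λ u v → [ m≤n⇒m≤n⊔o v , m≤n⇒m≤o⊔n u ]′) 0 _
    (inj₂ (lose (∈-filter⁺ (_≤? x) m∈L m≤x) ≤-refl))

maxAtMost-least : ∀ {x y} L → (∀ {m} → m ∈ L → m ≤ x → m ≤ y) → maxAtMost x L ≤ y
maxAtMost-least {x} L bound =
  foldr-preservesᵇ ⊔-lub z≤n
    (All.tabulate λ m∈ → let m∈L , m≤x = ∈-filter⁻ (_≤? x) m∈ in bound m∈L m≤x)

≤Θ⁻⇔ : ∀ {c} K x → c ≤ Θ⁻ K x ⇔ (∀ {m} → m ∈ partialSums K → m ≤ x → c + m ≤ x)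
≤Θ⁻⇔ {c} K x = mk⇔ to from
  where
  M = maxAtMost x (partialSums K)
  to : c ≤ x ∸ M → ∀ {m} → m ∈ partialSums K → m ≤ x → c + m ≤ x
  to c≤ m∈ m≤x = ≤-trans (+-monoʳ-≤ c (≤-maxAtMost m∈ m≤x))
    (m≤o∸n⇒m+n≤o c (maxAtMost-least (partialSums K) λ _ m≤x → m≤x) c≤)
  from : (∀ {m} → m ∈ partialSums K → m ≤ x → c + m ≤ x) → c ≤ x ∸ M
  from bound = subst (_≤ x ∸ M) (m∸[m∸n]≡n c≤x)
    (∸-monoʳ-≤ x (maxAtMost-least (partialSums K) λ m∈ m≤x →
      m+n≤o⇒m≤o∸n _ (subst (_≤ x) (+-comm c _) (bound m∈ m≤x))))
    where
    -- the empty prefix contributes the partial sum 0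
    c≤x : c ≤ x
    c≤x = subst (_≤ x) (+-identityʳ c) (bound (here refl) z≤n)

partialSums-reverse-∷ : ∀ x J → partialSums (reverse (x ∷ J)) ≡ partialSums (reverse J) ∷ʳ sum (x ∷ J)
partialSums-reverse-∷ x J = begin
  map sum (inits (reverse (x ∷ J)))                   ≡⟨ cong (map sum ∘ inits) (unfold-reverse x J) ⟩
  map sum (inits (reverse J ∷ʳ x))                    ≡⟨ cong (map sum) (inits-∷ʳ (reverse J) x) ⟩
  map sum (inits (reverse J) ∷ʳ (reverse J ∷ʳ x))     ≡⟨ map-++ sum (inits (reverse J)) _ ⟩
  partialSums (reverse J) ∷ʳ sum (reverse J ∷ʳ x)     ≡⟨ cong (λ K → partialSums (reverse J) ∷ʳ sum K) (unfold-reverse x J) ⟨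
  partialSums (reverse J) ∷ʳ sum (reverse (x ∷ J))    ≡⟨ cong (partialSums (reverse J) ∷ʳ_) (sum-reverse (x ∷ J)) ⟩
  partialSums (reverse J) ∷ʳ sum (x ∷ J)              ∎
  where open ≡-Reasoning

suffixSum∈partialSums-reverse : ∀ j J → sum (drop j J) ∈ partialSums (reverse J)
suffixSum∈partialSums-reverse zero    []      = here refl
suffixSum∈partialSums-reverse (suc j) []      = here refl
suffixSum∈partialSums-reverse zero    (x ∷ J) =
  subst (sum (x ∷ J) ∈_) (sym (partialSums-reverse-∷ x J)) (∈-++⁺ʳ (partialSums (reverse J)) (here refl))
suffixSum∈partialSums-reverse (suc j) (x ∷ J) =
  subst (sum (drop j J) ∈_) (sym (partialSums-reverse-∷ x J)) (∈-++⁺ˡ (suffixSum∈partialSums-reverse j J))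

∈partialSums-reverse⇒suffixSum : ∀ {m} J → m ∈ partialSums (reverse J) → ∃[ j ] m ≡ sum (drop j J)
∈partialSums-reverse⇒suffixSum []      (here refl) = 0 , refl
∈partialSums-reverse⇒suffixSum {m} (x ∷ J) m∈
  with ∈-++⁻ (partialSums (reverse J)) (subst (m ∈_) (partialSums-reverse-∷ x J) m∈)
... | inj₁ m∈′        = let j , m≡ = ∈partialSums-reverse⇒suffixSum J m∈′ in suc j , m≡
... | inj₂ (here m≡) = 0 , m≡

prefixSum : ℕ → List ℕ → ℕ
prefixSum k K = sum (take k K)

prefixSum-mono-≤ : ∀ {j k} K → j ≤ k → prefixSum j K ≤ prefixSum k K
prefixSum-mono-≤ {zero}  K        _         = z≤n
prefixSum-mono-≤ {suc j} []       _         = z≤n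
prefixSum-mono-≤ {suc j} (x ∷ K) (s≤s j≤k) = +-monoʳ-≤ x (prefixSum-mono-≤ K j≤k)

prefixSum+suffixSum : ∀ j K → prefixSum j K + sum (drop j K) ≡ sum K
prefixSum+suffixSum j K = trans (sym (sum-++ (take j K) (drop j K))) (cong sum (take++drop≡id j K))

-- InPart (suc b) I k says p = k+1, and InPart (suc b) (rotate I) k′ says q = k′+1 (idx-inPart).
record InPart (y : ℕ) (K : List ℕ) (k : ℕ) : Set where
  constructor inPart
  field
    below : prefixSum k K < y
    upto  : y ≤ prefixSum (suc k) K

inPart-∷⁻ : ∀ {y x K k} → InPart y (x ∷ K) (suc k) → InPart (y ∸ x) K k
inPart-∷⁻ {y} {x} {K} {k} (inPart below upto) =
  inPart (m+n≤o⇒m≤o∸n (suc (prefixSum k K)) (subst (_< y) (+-comm x _) below))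
         (m≤n+o⇒m∸n≤o y x upto)

inPart-∷⁺ : ∀ {y x K k} → x < y → InPart (y ∸ x) K k → InPart y (x ∷ K) (suc k)
inPart-∷⁺ {y} {x} {K} {k} x<y (inPart below upto) =
  inPart (subst (_< y) (+-comm (prefixSum k K) x) (m≤o∸n⇒m+n≤o (suc (prefixSum k K)) (<⇒≤ x<y) below))
         (≤-trans (m≤n+m∸n y x) (+-monoʳ-≤ x upto))

¬inPart-[] : ∀ {y k} → ¬ InPart y [] k
¬inPart-[] (inPart below upto) = <⇒≱ (≤-<-trans z≤n below) upto

∃inPart : ∀ {y} K → 0 < y → y ≤ sum K → ∃[ k ] InPart y K k
∃inPart [] 0<y y≤0 = ⊥-elim (<⇒≱ 0<y y≤0)
∃inPart {y} (x ∷ K) 0<y y≤sum with y ≤? x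
... | yes y≤x = 0 , inPart 0<y (subst (y ≤_) (sym (+-identityʳ x)) y≤x)
... | no  y≰x =
  let x<y = ≰⇒> y≰x
      k , p = ∃inPart K (m<n⇒0<n∸m x<y) (m≤n+o⇒m∸n≤o y x y≤sum)
  in suc k , inPart-∷⁺ x<y p

idx-inPart : ∀ {y K k} → InPart y K k → idx y K ≡ suc k
idx-inPart {K = []} p = ⊥-elim (¬inPart-[] p)
idx-inPart {y} {x ∷ K} {k} p with y ≤? x | k
... | yes _   | zero  = refl
... | yes y≤x | suc k = ⊥-elim (<⇒≱ (≤-<-trans (m≤m+n x _) (InPart.below p)) y≤x)
... | no  y≰x | zero  = ⊥-elim (y≰x (subst (y ≤_) (+-identityʳ x) (InPart.upto p)))
... | no  _   | suc k = cong suc (idx-inPart (inPart-∷⁻ p))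

inPart⇒<length : ∀ {y K k} → InPart y K k → k < length K
inPart⇒<length {K = []}                 p = ⊥-elim (¬inPart-[] p)
inPart⇒<length {K = x ∷ K} {k = zero}  _ = s≤s z≤n
inPart⇒<length {K = x ∷ K} {k = suc k} p = s≤s (inPart⇒<length (inPart-∷⁻ p))

inPart-< : ∀ {y K k j} → InPart y K k → y ≤ prefixSum j K → k < j
inPart-< {K = K} (inPart below _) y≤ = ≰⇒> λ j≤k → <⇒≱ below (≤-trans y≤ (prefixSum-mono-≤ K j≤k))

inPart-≥ : ∀ {y K k j} → InPart y K k → prefixSum j K < y → j ≤ k
inPart-≥ {K = K} (inPart _ upto) <y = ≮⇒≥ λ k<j → <⇒≱ <y (≤-trans upto (prefixSum-mono-≤ K k<j))

+-≤-exchange : ∀ {S D a B} c → S + D ≡ a + B → c + D ≤ a ⇔ c + B ≤ S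
+-≤-exchange {S} {D} {a} {B} c S+D≡a+B = mk⇔
  (λ c+D≤a → +-cancelʳ-≤ D (c + B) S (begin
    c + B + D   ≡⟨ +-assoc c B D ⟩
    c + (B + D) ≡⟨ cong (c +_) (+-comm B D) ⟩
    c + (D + B) ≡⟨ +-assoc c D B ⟨
    c + D + B   ≤⟨ +-monoˡ-≤ B c+D≤a ⟩
    a + B       ≡⟨ S+D≡a+B ⟨
    S + D       ∎))
  (λ c+B≤S → +-cancelʳ-≤ B (c + D) a (begin
    c + D + B   ≡⟨ +-assoc c D B ⟩
    c + (D + B) ≡⟨ cong (c +_) (+-comm D B) ⟩
    c + (B + D) ≡⟨ +-assoc c B D ⟨
    c + B + D   ≤⟨ +-monoˡ-≤ D c+B≤S ⟩
    S + D       ≡⟨ S+D≡a+B ⟩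
    a + B       ∎))
  where open ≤-Reasoning

≤Θ⁻-reverse⇔ : ∀ {a B c t} J → sum J ≡ a + B → InPart B J t →
  c ≤ Θ⁻ (reverse J) a ⇔ c + B ≤ prefixSum (suc t) J
≤Θ⁻-reverse⇔ {a} {B} {c} {t} J sumJ p = mk⇔ to from
  where
  split : ∀ j → prefixSum j J + sum (drop j J) ≡ a + B
  split j = trans (prefixSum+suffixSum j J) sumJ
  to : c ≤ Θ⁻ (reverse J) a → c + B ≤ prefixSum (suc t) J
  to c≤Θ = Equivalence.to (+-≤-exchange c (split (suc t)))
    (Equivalence.to (≤Θ⁻⇔ (reverse J) a) c≤Θ (suffixSum∈partialSums-reverse (suc t) J)
      (Equivalence.from (+-≤-exchange 0 (split (suc t))) (InPart.upto p)))
  from : c + B ≤ prefixSum (suc t) J → c ≤ Θ⁻ (reverse J) a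
  from c+B≤ = Equivalence.from (≤Θ⁻⇔ (reverse J) a) λ m∈ m≤a →
    let j , m≡ = ∈partialSums-reverse⇒suffixSum J m∈
        D≤a = subst (_≤ a) m≡ m≤a
        t<j = inPart-< {j = j} p (Equivalence.to (+-≤-exchange 0 (split j)) D≤a)
    in subst (λ m → c + m ≤ a) (sym m≡)
         (Equivalence.from (+-≤-exchange c (split j)) (≤-trans c+B≤ (prefixSum-mono-≤ J t<j)))

reversePrefix : ℕ → List ℕ → List ℕ
reversePrefix m K = reverse (take m K) ++ drop m K

reversePrefix-↭ : ∀ m K → reversePrefix m K ↭ K
reversePrefix-↭ m K =
  subst (reversePrefix m K ↭_) (take++drop≡id m K) (++⁺ʳ (drop m K) (↭-reverse (take m K)))

length-reversePrefix : ∀ m K → length (reversePrefix m K) ≡ length K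
length-reversePrefix m K = ↭-length (reversePrefix-↭ m K)

take-reversePrefix : ∀ {m} K → m ≤ length K → take m (reversePrefix m K) ≡ reverse (take m K)
take-reversePrefix K m≤ = take-++-exact _ _ (length-reverse-take K m≤)

drop-reversePrefix : ∀ {m} K → m ≤ length K → drop m (reversePrefix m K) ≡ drop m K
drop-reversePrefix K m≤ = drop-++-exact _ _ (length-reverse-take K m≤)

reversePrefix-involutive : ∀ {m} K → m ≤ length K → reversePrefix m (reversePrefix m K) ≡ K
reversePrefix-involutive {m} K m≤ = begin
  reverse (take m (reversePrefix m K)) ++ drop m (reversePrefix m K)
    ≡⟨ cong₂ (λ X Y → reverse X ++ Y) (take-reversePrefix K m≤) (drop-reversePrefix K m≤) ⟩
  reverse (reverse (take m K)) ++ drop m K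
    ≡⟨ cong (_++ drop m K) (reverse-involutive (take m K)) ⟩
  take m K ++ drop m K
    ≡⟨ take++drop≡id m K ⟩
  K ∎
  where open ≡-Reasoning

prefixSum-reversePrefix : ∀ {m} K → m ≤ length K → prefixSum m (reversePrefix m K) ≡ prefixSum m K
prefixSum-reversePrefix {m} K m≤ = trans (cong sum (take-reversePrefix K m≤)) (sum-reverse (take m K))

rotate-↭ : ∀ K → rotate K ↭ K
rotate-↭ []      = ↭-refl
rotate-↭ (x ∷ K) = ++-comm K [ x ]

prefixSum-rotate : ∀ {t} x K → t ≤ length K → prefixSum t (rotate (x ∷ K)) ≡ prefixSum t K
prefixSum-rotate x K t≤ = cong sum (take-++-short K [ x ] t≤)

prefixSum-suc-rotate : ∀ {t} K → suc t ≤ length K → prefixSum (suc t) K ≡ head₀ K + prefixSum t (rotate K)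
prefixSum-suc-rotate (x ∷ K) (s≤s t≤) = cong (x +_) (sym (prefixSum-rotate x K t≤))

prefixSum-reversePrefix-suc : ∀ {t} K → suc t ≤ length K →
  prefixSum t (reversePrefix (suc t) K) ≡ prefixSum t (rotate K)
prefixSum-reversePrefix-suc {t} (x ∷ K) (s≤s t≤) = begin
  sum (take t (reverse (x ∷ take t K) ++ drop t K))
    ≡⟨ cong (λ X → sum (take t (X ++ drop t K))) (unfold-reverse x (take t K)) ⟩
  sum (take t ((reverse (take t K) ∷ʳ x) ++ drop t K))
    ≡⟨ cong (sum ∘ take t) (++-assoc (reverse (take t K)) [ x ] (drop t K)) ⟩
  sum (take t (reverse (take t K) ++ x ∷ drop t K))
    ≡⟨ cong sum (take-++-exact (reverse (take t K)) (x ∷ drop t K) (length-reverse-take K t≤)) ⟩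
  sum (reverse (take t K))
    ≡⟨ sum-reverse (take t K) ⟩
  prefixSum t K
    ≡⟨ prefixSum-rotate x K t≤ ⟨
  prefixSum t (rotate (x ∷ K)) ∎
  where open ≡-Reasoning

prefixSum-rotate-reversePrefix : ∀ {t} K → suc t ≤ length K →
  prefixSum t (rotate (reversePrefix (suc t) K)) ≡ prefixSum t K
prefixSum-rotate-reversePrefix {t} K t<len = begin
  prefixSum t (rotate J)                 ≡⟨ prefixSum-reversePrefix-suc J t<lenJ ⟨
  prefixSum t (reversePrefix (suc t) J)  ≡⟨ cong (prefixSum t) (reversePrefix-involutive K t<len) ⟩
  prefixSum t K                          ∎
  where
  open ≡-Reasoning
  J = reversePrefix (suc t) K
  t<lenJ = subst (suc t ≤_) (sym (length-reversePrefix (suc t) K)) t<len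

prefixSum-suc-reversePrefix : ∀ {t} K → suc t ≤ length K →
  prefixSum (suc t) K ≡ head₀ (reversePrefix (suc t) K) + prefixSum t K
prefixSum-suc-reversePrefix {t} K t<len = begin
  prefixSum (suc t) K                     ≡⟨ prefixSum-reversePrefix K t<len ⟨
  prefixSum (suc t) J                     ≡⟨ prefixSum-suc-rotate J t<lenJ ⟩
  head₀ J + prefixSum t (rotate J)        ≡⟨ cong (head₀ J +_) (prefixSum-rotate-reversePrefix K t<len) ⟩
  head₀ J + prefixSum t K                 ∎
  where
  open ≡-Reasoning
  J = reversePrefix (suc t) K
  t<lenJ = subst (suc t ≤_) (sym (length-reversePrefix (suc t) K)) t<len

inPart-reversePrefix : ∀ {y I k k′ t} → InPart y I k → InPart y (rotate I) k′ → k < t → t ≤ k′ →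
  let J = reversePrefix (suc t) I in InPart y J t × head₀ J + y ≤ prefixSum (suc t) J
inPart-reversePrefix {y} {I} {k} {k′} {t} p q k<t t≤k′ = inPart below upto , head+y≤
  where
  J = reversePrefix (suc t) I
  t<len : suc t ≤ length I
  t<len = ≤-trans (s≤s t≤k′) (subst (suc k′ ≤_) (↭-length (rotate-↭ I)) (inPart⇒<length q))
  below : prefixSum t J < y
  below = subst (_< y) (sym (prefixSum-reversePrefix-suc I t<len))
    (≤-<-trans (prefixSum-mono-≤ (rotate I) t≤k′) (InPart.below q))
  head+y≤ : head₀ J + y ≤ prefixSum (suc t) J
  head+y≤ = subst (head₀ J + y ≤_)
    (sym (trans (prefixSum-reversePrefix I t<len) (prefixSum-suc-reversePrefix I t<len)))
    (+-monoʳ-≤ (head₀ J) (≤-trans (InPart.upto p) (prefixSum-mono-≤ I k<t)))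
  upto : y ≤ prefixSum (suc t) J
  upto = ≤-trans (m≤n+m y (head₀ J)) head+y≤

inPart-reversePrefix⁻ : ∀ {y J t k k′} → InPart y J t → head₀ J + y ≤ prefixSum (suc t) J →
  let I = reversePrefix (suc t) J in InPart y I k → InPart y (rotate I) k′ → k < t × t ≤ k′
inPart-reversePrefix⁻ {y} {J} {t} pJ head+y≤ p q =
  inPart-< p y≤ , inPart-≥ q (subst (_< y) (sym (prefixSum-rotate-reversePrefix J t<len)) (InPart.below pJ))
  where
  t<len = inPart⇒<length pJ
  y≤ : y ≤ prefixSum t (reversePrefix (suc t) J)
  y≤ = subst (y ≤_) (sym (prefixSum-reversePrefix-suc J t<len))
    (+-cancelˡ-≤ (head₀ J) y _ (subst (head₀ J + y ≤_) (prefixSum-suc-rotate J t<len) head+y≤))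

∸-interval⇒ : ∀ {k k′ r} → 1 ≤ r → r ≤ k′ ∸ k → k < k + r × k + r ≤ k′
∸-interval⇒ {k} {k′} {r} 1≤r r≤ =
  m<m+n k 1≤r , subst (_≤ k′) (+-comm r k) (m≤o∸n⇒m+n≤o r (<⇒≤ k<k′) r≤)
  where
  k<k′ : k < k′
  k<k′ = m∸n≢0⇒n<m (m<n⇒n≢0 (≤-trans 1≤r r≤))

shift-interval⇔ : ∀ {k k′} (P : ℕ → Set) →
  (∃[ r ] (1 ≤ r × r ≤ k′ ∸ k × P (k + r))) ⇔ (∃[ t ] (k < t × t ≤ k′ × P t))
shift-interval⇔ {k} P = mk⇔
  (λ (r , 1≤r , r≤ , P[k+r]) → let k<t , t≤k′ = ∸-interval⇒ 1≤r r≤ in k + r , k<t , t≤k′ , P[k+r])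
  (λ (t , k<t , t≤k′ , Pt) →
    t ∸ k , m<n⇒0<n∸m k<t , ∸-monoˡ-≤ k t≤k′ , subst P (sym (m+[n∸m]≡n (<⇒≤ k<t))) Pt)

a+b+1≡a+[1+b] : ∀ a b → a + b + 1 ≡ a + suc b
a+b+1≡a+[1+b] a b = trans (+-assoc a b 1) (cong (a +_) (+-comm b 1))

∃inPart[1+b] : ∀ {a b} K → sum K ≡ a + b + 1 → ∃[ k ] InPart (suc b) K k
∃inPart[1+b] {a} {b} K sumK =
  ∃inPart K (s≤s z≤n) (subst (suc b ≤_) (sym (trans sumK (a+b+1≡a+[1+b] a b))) (m≤n+m (suc b) a))

H≡reversePrefix : ∀ {b K k} r → InPart (suc b) K k → H b K r ≡ reversePrefix (suc k + r) K
H≡reversePrefix {K = K} r p = cong (λ m → reversePrefix (m + r) K) (idx-inPart p)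

R≡drop : ∀ {b K k} r → InPart (suc b) K k → R b K r ≡ drop (suc k + r) K
R≡drop {K = K} r p = cong (λ m → drop (m + r) K) (idx-inPart p)

ψ≡reversePrefix : ∀ {b K k} → InPart (suc b) K k → ψ b K ≡ reversePrefix (suc k) K
ψ≡reversePrefix {K = K} {k} p =
  trans (H≡reversePrefix 0 p) (cong (λ m → reversePrefix m K) (+-identityʳ (suc k)))

reversePrefix-InW : ∀ {n} m K → InW n K → InW n (reversePrefix m K)
reversePrefix-InW m K (allK , sumK) =
  All-resp-↭ (↭-sym (reversePrefix-↭ m K)) allK , trans (sum-↭ (reversePrefix-↭ m K)) sumK

reversePrefix-preimage : ∀ {a b I k k′ t} → InW (a + b + 1) I →
  InPart (suc b) I k → InPart (suc b) (rotate I) k′ → k < t → t ≤ k′ →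
  let J = reversePrefix (suc t) I in InW (a + b + 1) J × ψ b J ≡ I × head₀ J ≤ Θ⁻ (reverse J) a
reversePrefix-preimage {a} {b} {I} {t = t} wI p q k<t t≤k′ =
  wJ ,
  trans (ψ≡reversePrefix pJ) (reversePrefix-involutive I t<len) ,
  Equivalence.from (≤Θ⁻-reverse⇔ J (trans (proj₂ wJ) (a+b+1≡a+[1+b] a b)) pJ) head+y≤
  where
  J = reversePrefix (suc t) I
  wJ = reversePrefix-InW (suc t) I wI
  pJ = proj₁ (inPart-reversePrefix p q k<t t≤k′)
  head+y≤ = proj₂ (inPart-reversePrefix p q k<t t≤k′)
  t<len = subst (suc t ≤_) (length-reversePrefix (suc t) I) (inPart⇒<length pJ)

preimage-reversePrefix : ∀ {a b I J k k′ t} → sum J ≡ a + b + 1 → InPart (suc b) J t →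
  ψ b J ≡ I → head₀ J ≤ Θ⁻ (reverse J) a → InPart (suc b) I k → InPart (suc b) (rotate I) k′ →
  k < t × t ≤ k′ × J ≡ reversePrefix (suc t) I
preimage-reversePrefix {a} {b} {J = J} {k} {k′} {t} sumJ pJ refl head≤Θ p q =
  proj₁ range , proj₂ range ,
  sym (trans (cong (reversePrefix (suc t)) I≡) (reversePrefix-involutive J (inPart⇒<length pJ)))
  where
  I≡ = ψ≡reversePrefix pJ
  head+y≤ = Equivalence.to (≤Θ⁻-reverse⇔ J (trans sumJ (a+b+1≡a+[1+b] a b)) pJ) head≤Θ
  range = inPart-reversePrefix⁻ pJ head+y≤ (subst (λ I → InPart (suc b) I k) I≡ p)
                                           (subst (λ I → InPart (suc b) (rotate I) k′) I≡ q)

preimage⇔reversePrefix : ∀ {a b I k k′} → InW (a + b + 1) I →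
  InPart (suc b) I k → InPart (suc b) (rotate I) k′ → ∀ J →
  (InW (a + b + 1) J × ψ b J ≡ I × head₀ J ≤ Θ⁻ (reverse J) a)
    ⇔ (∃[ t ] (k < t × t ≤ k′ × J ≡ reversePrefix (suc t) I))
preimage⇔reversePrefix wI p q J = mk⇔
  (λ (wJ , ψJ≡I , head≤Θ) →
    let t , pJ = ∃inPart[1+b] J (proj₂ wJ) in t , preimage-reversePrefix (proj₂ wJ) pJ ψJ≡I head≤Θ p q)
  (λ { (t , k<t , t≤k′ , refl) → reversePrefix-preimage wI p q k<t t≤k′ })

qOf∸pOf≡ : ∀ {b I k k′} → InPart (suc b) I k → InPart (suc b) (rotate I) k′ → qOf b I ∸ pOf b I ≡ k′ ∸ k
qOf∸pOf≡ p q = cong₂ _∸_ (idx-inPart q) (idx-inPart p)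

H-range⇔ : ∀ {b I J k k′} → InPart (suc b) I k → InPart (suc b) (rotate I) k′ →
  (∃[ r ] (1 ≤ r × r ≤ qOf b I ∸ pOf b I × J ≡ H b I r))
    ⇔ (∃[ t ] (k < t × t ≤ k′ × J ≡ reversePrefix (suc t) I))
H-range⇔ {b} {I} {J} p q = ⇔.trans (mk⇔ to from) (shift-interval⇔ (λ t → J ≡ reversePrefix (suc t) I))
  where
  to = λ (r , 1≤r , r≤ , J≡) → r , 1≤r , subst (r ≤_) (qOf∸pOf≡ p q) r≤ , trans J≡ (H≡reversePrefix r p)
  from = λ (r , 1≤r , r≤ , J≡) →
    r , 1≤r , subst (r ≤_) (sym (qOf∸pOf≡ p q)) r≤ , trans J≡ (sym (H≡reversePrefix r p))

R-H≡R : ∀ {b I k k′} → InPart (suc b) I k → InPart (suc b) (rotate I) k′ →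
  ∀ r → 1 ≤ r → r ≤ qOf b I ∸ pOf b I → R b (H b I r) 0 ≡ R b I r
R-H≡R {b} {I} {k} p q r 1≤r r≤ = begin
  R b (H b I r) 0     ≡⟨ cong (λ K → R b K 0) (H≡reversePrefix r p) ⟩
  R b J 0             ≡⟨ R≡drop 0 pJ ⟩
  drop (suc t + 0) J  ≡⟨ cong (λ m → drop m J) (+-identityʳ (suc t)) ⟩
  drop (suc t) J      ≡⟨ drop-reversePrefix I t<len ⟩
  drop (suc t) I      ≡⟨ R≡drop r p ⟨
  R b I r             ∎
  where
  open ≡-Reasoning
  t = k + r
  J = reversePrefix (suc t) I
  t-bounds = ∸-interval⇒ 1≤r (subst (r ≤_) (qOf∸pOf≡ p q) r≤)
  pJ = proj₁ (inPart-reversePrefix p q (proj₁ t-bounds) (proj₂ t-bounds))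
  t<len = subst (suc t ≤_) (length-reversePrefix (suc t) I) (inPart⇒<length pJ)

proposition4p3 : (a b : ℕ) → b ≤ a → 2 ≤ b →
    (I : List ℕ) → InW (a + b + 1) I → Θ⁻ (reverse I) a < head₀ I →
      ((r : ℕ) → 1 ≤ r → r ≤ qOf b I ∸ pOf b I → R b (H b I r) 0 ≡ R b I r)
      × ((J : List ℕ) →
          (InW (a + b + 1) J × ψ b J ≡ I × head₀ J ≤ Θ⁻ (reverse J) a)
          ⇔ (∃[ r ] (1 ≤ r × r ≤ qOf b I ∸ pOf b I × J ≡ H b I r)))
proposition4p3 a b _ _ I wI@(_ , sumI) _
  with ∃inPart[1+b] I sumI | ∃inPart[1+b] (rotate I) (trans (sum-↭ (rotate-↭ I)) sumI)
... | k , p | k′ , q =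
  R-H≡R p q , λ J → ⇔.trans (preimage⇔reversePrefix wI p q J) (⇔.sym (H-range⇔ p q))
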